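{- For integers $k$ let $t=\lfloor\sqrt{k}\rfloor$ and, when $t\ge 4$, let $\Gamma(k-2t,t)$ denote the number of permitted sequences with parameters $k-2t$ and $t$. Then $$\liminf_{k\to\infty}\sqrt[k]{\Gamma(k-2t,t)}\ge 4.$$
   Context: A sequence $[\gamma_1,\dots,\gamma_{k-2t}]$ of non-negative integers is permitted with parameters $k-2t$ and $t$ if (i) $\gamma_1=0$, (ii) $\gamma_{i+1}\le\gamma_i+1$ for all $i$, and (iii) $\gamma_i\le t-2$ for all $i$. -}

module Defs where

open import Data.Nat using (ℕ; zero; suc; _≤_; _∸_; _≟_; _≤?_)
open import Data.Fin using (Fin; toℕ)
open import Data.Fin.Properties using (all?)
open import Data.Vec using (Vec; []; _∷_; lookup)
open import Data.List using (List; [_]; concatMap; map; upTo; filter; length)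
open import Data.Product using (_×_)
open import Relation.Nullary using (Dec)
open import Relation.Nullary.Decidable using (_×-dec_; _→-dec_)
open import Relation.Binary.PropositionalEquality using (_≡_)

-- A sequence [γ_1, …, γ_n] (here n = k - 2t), indexed from 0 in Agda,
-- is permitted with parameters n and t if
--  (i)   γ_1 = 0,
--  (ii)  γ_{i+1} ≤ γ_i + 1 for all i,
--  (iii) γ_i ≤ t - 2 for all i.
Permitted : (n t : ℕ) → Vec ℕ n → Set
Permitted n t γ =
  (∀ (i : Fin n) → toℕ i ≡ 0 → lookup γ i ≡ 0)
  × ((∀ (i j : Fin n) → toℕ j ≡ suc (toℕ i) → lookup γ j ≤ suc (lookup γ i))
  × (∀ (i : Fin n) → lookup γ i ≤ t ∸ 2))

permitted? : (n t : ℕ) → (γ : Vec ℕ n) → Dec (Permitted n t γ)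
permitted? n t γ =
  all? (λ i → (toℕ i ≟ 0) →-dec (lookup γ i ≟ 0))
  ×-dec (all? (λ i → all? (λ j → (toℕ j ≟ suc (toℕ i)) →-dec (lookup γ j ≤? suc (lookup γ i))))
  ×-dec all? (λ i → lookup γ i ≤? t ∸ 2))

allVecs : (n b : ℕ) → List (Vec ℕ n)
allVecs zero    b = [ [] ]
allVecs (suc n) b = concatMap (λ x → map (x ∷_) (allVecs n b)) (upTo b)

-- Γ(n, t): the number of permitted sequences with parameters n and t.
-- Every permitted sequence has entries in {0, …, t-2}, so it suffices to
-- count the permitted ones among allVecs n (t - 1).
Γ : ℕ → ℕ → ℕ
Γ n t = length (filter (permitted? n t) (allVecs n (suc (t ∸ 2))))

-- Γ(n, t) counts the walks of length n, starting at 0, of the transfer operator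
-- (T w)(h) = Σ_{x ≤ h+1} w(x) truncated at height t - 2. Without the ceiling, 2^h is an
-- approximate eigenvector of T with eigenvalue 4. The potential φ(h) = 2^h (h+1)(M-h),
-- which vanishes from height M on, satisfies (e+1) (T φ)(h) ≥ 4e φ(h) when M = 2(e+1),
-- so there are at least a constant times (4e/(e+1))^m walks of length m once t - 2 ≥ M.
-- Taking e = 4q makes this rate exceed (4q-1)/q, and since t ≈ √k the 2t entries lost
-- in Γ(k-2t, t) only cost a subexponential factor.
module Submission where

open import Defs
open import Data.Nat using (ℕ; zero; suc; _+_; _*_; _∸_; _^_; _≤_; _<_; z≤n; s≤s; _≤?_; _<?_;
  NonZero; _≤′_; ≤′-refl; ≤′-step)
open import Data.Nat.Properties
open import Data.Nat.ListAction using (sum)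
open import Data.Nat.ListAction.Properties using (sum-++)
open import Data.Nat.Tactic.RingSolver using (solve-∀)
open import Data.Product using (∃; _×_; _,_)
open import Data.Unit using (⊤; tt)
open import Data.Empty using (⊥-elim)
open import Data.Fin using (Fin; toℕ) renaming (zero to fzero; suc to fsuc)
open import Data.Vec using (Vec; []; _∷_; lookup)
open import Data.List using (List; []; _∷_; [_]; _++_; _∷ʳ_; map; concat; concatMap; filter; length; upTo)
open import Data.List.Properties using (map-++; upTo-∷ʳ; filter-++; length-++)
open import Function using (_∘_)
open import Relation.Nullary using (Dec; yes; no)
open import Relation.Nullary.Decidable using (_×-dec_)
open import Relation.Binary.PropositionalEquality using (_≡_; refl; sym; trans; cong; cong₂; subst; module ≡-Reasoning)

∑< : ℕ → (ℕ → ℕ) → ℕ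
∑< zero    f = 0
∑< (suc n) f = ∑< n f + f n

sum-map-upTo : ∀ (f : ℕ → ℕ) n → sum (map f (upTo n)) ≡ ∑< n f
sum-map-upTo f zero    = refl
sum-map-upTo f (suc n) = begin
  sum (map f (upTo (suc n)))       ≡⟨ cong (sum ∘ map f) (sym (upTo-∷ʳ n)) ⟩
  sum (map f (upTo n ∷ʳ n))        ≡⟨ cong sum (map-++ f (upTo n) [ n ]) ⟩
  sum (map f (upTo n) ++ [ f n ])  ≡⟨ sum-++ (map f (upTo n)) [ f n ] ⟩
  sum (map f (upTo n)) + (f n + 0) ≡⟨ cong₂ _+_ (sum-map-upTo f n) (+-identityʳ (f n)) ⟩
  ∑< n f + f n                     ∎
  where open ≡-Reasoning

∑<-mono-≤ : ∀ n {f g : ℕ → ℕ} → (∀ x → x < n → f x ≤ g x) → ∑< n f ≤ ∑< n g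
∑<-mono-≤ zero    f≤g = z≤n
∑<-mono-≤ (suc n) f≤g =
  +-mono-≤ (∑<-mono-≤ n (λ x x<n → f≤g x (m<n⇒m<1+n x<n))) (f≤g n (n<1+n n))

∑<-monoˡ-≤ : ∀ (f : ℕ → ℕ) {m n} → m ≤ n → ∑< m f ≤ ∑< n f
∑<-monoˡ-≤ f = go ∘ ≤⇒≤′
  where
  go : ∀ {m n} → m ≤′ n → ∑< m f ≤ ∑< n f
  go ≤′-refl     = ≤-refl
  go (≤′-step p) = ≤-trans (go p) (m≤m+n _ _)

∑<-distribʳ-* : ∀ n (f : ℕ → ℕ) c → ∑< n f * c ≡ ∑< n (λ x → f x * c)
∑<-distribʳ-* zero    f c = refl
∑<-distribʳ-* (suc n) f c =
  trans (*-distribʳ-+ c (∑< n f) (f n)) (cong (_+ f n * c) (∑<-distribʳ-* n f c))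

module _ {A : Set} {P : A → Set} (P? : ∀ x → Dec (P x)) where

  length-filter-++ : ∀ xs ys →
    length (filter P? (xs ++ ys)) ≡ length (filter P? xs) + length (filter P? ys)
  length-filter-++ xs ys = trans (cong length (filter-++ P? xs ys)) (length-++ (filter P? xs))

  length-filter-concatMap : ∀ {C : Set} (f : C → List A) xs →
    length (filter P? (concatMap f xs)) ≡ sum (map (λ x → length (filter P? (f x))) xs)
  length-filter-concatMap f []       = refl
  length-filter-concatMap f (x ∷ xs) =
    trans (length-filter-++ (f x) (concat (map f xs)))
          (cong (length (filter P? (f x)) +_) (length-filter-concatMap f xs))

  length-filter-map-≥ : ∀ {C : Set} {Q : C → Set} (Q? : ∀ y → Dec (Q y)) (f : C → A) →
    (∀ y → Q y → P (f y)) → ∀ ys → length (filter Q? ys) ≤ length (filter P? (map f ys))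
  length-filter-map-≥ Q? f Q⇒P []       = z≤n
  length-filter-map-≥ Q? f Q⇒P (y ∷ ys) with Q? y | P? (f y)
  ... | yes _  | yes _  = s≤s (length-filter-map-≥ Q? f Q⇒P ys)
  ... | yes Qy | no ¬Pf = ⊥-elim (¬Pf (Q⇒P y Qy))
  ... | no _   | yes _  = m≤n⇒m≤1+n (length-filter-map-≥ Q? f Q⇒P ys)
  ... | no _   | no _   = length-filter-map-≥ Q? f Q⇒P ys

length-filter-allVecs-suc : ∀ {n} {P : Vec ℕ (suc n) → Set} (P? : ∀ γ → Dec (P γ)) b →
  length (filter P? (allVecs (suc n) b))
    ≡ ∑< b (λ x → length (filter P? (map (x ∷_) (allVecs n b))))
length-filter-allVecs-suc {n} P? b =
  trans (length-filter-concatMap P? (λ x → map (x ∷_) (allVecs n b)) (upTo b))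
        (sum-map-upTo (λ x → length (filter P? (map (x ∷_) (allVecs n b)))) b)

-- h is the entry preceding γ.
Continuation : (B h : ℕ) {n : ℕ} → Vec ℕ n → Set
Continuation B h []      = ⊤
Continuation B h (x ∷ γ) = x ≤ suc h × x ≤ B × Continuation B x γ

continuation? : ∀ B h {n} (γ : Vec ℕ n) → Dec (Continuation B h γ)
continuation? B h []      = yes tt
continuation? B h (x ∷ γ) = (x ≤? suc h) ×-dec ((x ≤? B) ×-dec continuation? B x γ)

continuations : (B h n : ℕ) → ℕ
continuations B h n = length (filter (continuation? B h) (allVecs n (suc B)))

continuations-suc : ∀ {B h} n → h < B →
  ∑< (2 + h) (λ x → continuations B x n) ≤ continuations B h (suc n)
continuations-suc {B} {h} n h<B = begin
  ∑< (2 + h) (λ x → continuations B x n) ≤⟨ ∑<-mono-≤ (2 + h) extend ⟩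
  ∑< (2 + h) children                    ≤⟨ ∑<-monoˡ-≤ children (s≤s h<B) ⟩
  ∑< (suc B) children                    ≡⟨ length-filter-allVecs-suc {n} (continuation? B h) (suc B) ⟨
  continuations B h (suc n)              ∎
  where
  open ≤-Reasoning
  children : ℕ → ℕ
  children x = length (filter (continuation? B h) (map (x ∷_) (allVecs n (suc B))))
  extend : ∀ x → x < 2 + h → continuations B x n ≤ children x
  extend x (s≤s x≤1+h) = length-filter-map-≥ (continuation? B h) (continuation? B x) (x ∷_)
    (λ _ γ-ok → x≤1+h , ≤-trans x≤1+h h<B , γ-ok) (allVecs n (suc B))

continuation-≤ : ∀ {B h n} (γ : Vec ℕ n) → Continuation B h γ → ∀ i → lookup γ i ≤ B
continuation-≤ (x ∷ γ) (_ , x≤B , _)  fzero    = x≤B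
continuation-≤ (x ∷ γ) (_ , _ , γ-ok) (fsuc i) = continuation-≤ γ γ-ok i

continuation-steps : ∀ {B h n} (γ : Vec ℕ n) → Continuation B h γ → ∀ (i j : Fin (suc n)) →
  toℕ j ≡ suc (toℕ i) → lookup (h ∷ γ) j ≤ suc (lookup (h ∷ γ) i)
continuation-steps (x ∷ γ) (x≤1+h , _ , _) fzero    (fsuc fzero)    _  = x≤1+h
continuation-steps (x ∷ γ) (_ , _ , γ-ok)  (fsuc i) (fsuc j)        eq =
  continuation-steps γ γ-ok i j (suc-injective eq)
continuation-steps γ       _               fzero    fzero           ()
continuation-steps (x ∷ γ) _               fzero    (fsuc (fsuc j)) ()
continuation-steps γ       _               (fsuc i) fzero           ()

continuation⇒permitted : ∀ t {m} (γ : Vec ℕ m) → Continuation (t ∸ 2) 0 γ →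
  Permitted (suc m) t (0 ∷ γ)
continuation⇒permitted t γ γ-ok = starts-at-0 , continuation-steps γ γ-ok , below-ceiling
  where
  starts-at-0 : ∀ i → toℕ i ≡ 0 → lookup (0 ∷ γ) i ≡ 0
  starts-at-0 fzero    _ = refl
  starts-at-0 (fsuc i) ()
  below-ceiling : ∀ i → lookup (0 ∷ γ) i ≤ t ∸ 2
  below-ceiling fzero    = z≤n
  below-ceiling (fsuc i) = continuation-≤ γ γ-ok i

continuations≤Γ : ∀ t m → continuations (t ∸ 2) 0 m ≤ Γ (suc m) t
continuations≤Γ t m = begin
  continuations (t ∸ 2) 0 m ≤⟨ length-filter-map-≥ (permitted? (suc m) t) (continuation? (t ∸ 2) 0)
                                 (0 ∷_) (continuation⇒permitted t) (allVecs m b) ⟩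
  ∑< 1 children             ≤⟨ ∑<-monoˡ-≤ children (s≤s z≤n) ⟩
  ∑< b children             ≡⟨ length-filter-allVecs-suc {m} (permitted? (suc m) t) b ⟨
  Γ (suc m) t               ∎
  where
  open ≤-Reasoning
  b : ℕ
  b = suc (t ∸ 2)
  children : ℕ → ℕ
  children x = length (filter (permitted? (suc m) t) (map (x ∷_) (allVecs m b)))

-- f is a sub-eigenvector, with ratio c / E, of the transfer operator truncated at B.
module _ {B F c E : ℕ} {f : ℕ → ℕ}
         (f≤F : ∀ h → f h ≤ F)
         (f-support : ∀ h → B ≤ h → f h ≡ 0)
         (f-subEigen : ∀ h → h < B → c * f h ≤ E * ∑< (2 + h) f) where

  continuations-growth : ∀ n h → f h * c ^ n ≤ continuations B h n * (F * E ^ n)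
  continuations-growth zero h = begin
    f h * 1       ≡⟨ *-identityʳ (f h) ⟩
    f h           ≤⟨ f≤F h ⟩
    F             ≡⟨ *-identityʳ F ⟨
    F * 1         ≡⟨ *-identityˡ (F * 1) ⟨
    1 * (F * 1)   ∎
    where open ≤-Reasoning
  continuations-growth (suc n) h with h <? B
  ... | no h≮B rewrite f-support h (≮⇒≥ h≮B) = z≤n
  ... | yes h<B = begin
    f h * (c * c ^ n)                                  ≡⟨ regroup (f h) c (c ^ n) ⟩
    c * f h * c ^ n                                    ≤⟨ *-monoˡ-≤ (c ^ n) (f-subEigen h h<B) ⟩
    E * ∑< (2 + h) f * c ^ n                           ≡⟨ *-assoc E _ (c ^ n) ⟩
    E * (∑< (2 + h) f * c ^ n)                         ≡⟨ cong (E *_) (∑<-distribʳ-* (2 + h) f (c ^ n)) ⟩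
    E * ∑< (2 + h) (λ x → f x * c ^ n)                 ≤⟨ *-monoʳ-≤ E (∑<-mono-≤ (2 + h)
                                                            (λ x _ → continuations-growth n x)) ⟩
    E * ∑< (2 + h) (λ x → continuations B x n * K)     ≡⟨ cong (E *_) (∑<-distribʳ-* (2 + h) _ K) ⟨
    E * (∑< (2 + h) (λ x → continuations B x n) * K)   ≤⟨ *-monoʳ-≤ E (*-monoˡ-≤ K (continuations-suc n h<B)) ⟩
    E * (continuations B h (suc n) * K)                ≡⟨ regroup′ E (continuations B h (suc n)) F (E ^ n) ⟩
    continuations B h (suc n) * (F * (E * E ^ n))      ∎
    where
    open ≤-Reasoning
    K : ℕ
    K = F * E ^ n
    regroup : ∀ a c d → a * (c * d) ≡ c * a * d
    regroup = solve-∀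
    regroup′ : ∀ e g a d → e * (g * (a * d)) ≡ g * (a * (e * d))
    regroup′ = solve-∀

φ : ℕ → ℕ → ℕ
φ M h = 2 ^ h * (suc h * (M ∸ h))

φ-max : ℕ → ℕ
φ-max M = 2 ^ M * (suc M * M)

φ-support : ∀ M h → M ≤ h → φ M h ≡ 0
φ-support M h M≤h rewrite m≤n⇒m∸n≡0 M≤h | *-zeroʳ (suc h) = *-zeroʳ (2 ^ h)

φ≤φ-max : ∀ M h → φ M h ≤ φ-max M
φ≤φ-max M h with h ≤? M
... | yes h≤M = *-mono-≤ (^-monoʳ-≤ 2 h≤M) (*-mono-≤ (s≤s h≤M) (m∸n≤m M h))
... | no h≰M rewrite φ-support M h (<⇒≤ (≰⇒> h≰M)) = z≤n

m∸n≡1+[m∸1+n] : ∀ {m n} → n < m → m ∸ n ≡ suc (m ∸ suc n)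
m∸n≡1+[m∸1+n] {suc m} {zero}  _         = refl
m∸n≡1+[m∸1+n] {suc m} {suc n} (s≤s n<m) = m∸n≡1+[m∸1+n] n<m

φ-step : ∀ M h → 2 + h ≤ M → 4 * φ M h + φ M (2 + h) + 2 ^ (3 + h) ≡ 4 * φ M (1 + h)
φ-step M h 2+h≤M
  rewrite m∸n≡1+[m∸1+n] (<-trans (n<1+n h) 2+h≤M) | m∸n≡1+[m∸1+n] 2+h≤M
        | ^-distribˡ-+-* 2 3 h = expand (2 ^ h) h (M ∸ (2 + h))
  where
  expand : ∀ P h d → 4 * (P * (suc h * suc (suc d))) + 2 * (2 * P) * (suc (suc (suc h)) * d) + 8 * P
                     ≡ 4 * (2 * P * (suc (suc h) * suc d))
  expand = solve-∀

∑<φ : ∀ M h → h < M → ∑< (2 + h) (φ M) + 2 ^ (3 + h) ≡ 4 * φ M h + M + 4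
∑<φ (suc M) zero    _   = base M
  where
  base : ∀ M → 0 + 1 * (1 * suc M) + 2 * (2 * M) + 8 ≡ 4 * (1 * (1 * suc M)) + suc M + 4
  base = solve-∀
∑<φ M       (suc h) 1+h<M = begin
  ∑< (2 + h) (φ M) + φ M (2 + h) + 2 * 2 ^ (3 + h)
    ≡⟨ regroup (∑< (2 + h) (φ M)) (φ M (2 + h)) (2 ^ (3 + h)) ⟩
  (∑< (2 + h) (φ M) + 2 ^ (3 + h)) + φ M (2 + h) + 2 ^ (3 + h)
    ≡⟨ cong (λ s → s + φ M (2 + h) + 2 ^ (3 + h)) (∑<φ M h (<⇒≤ 1+h<M)) ⟩
  4 * φ M h + M + 4 + φ M (2 + h) + 2 ^ (3 + h)
    ≡⟨ regroup′ (4 * φ M h) M (φ M (2 + h)) (2 ^ (3 + h)) ⟩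
  4 * φ M h + φ M (2 + h) + 2 ^ (3 + h) + M + 4
    ≡⟨ cong (λ s → s + M + 4) (φ-step M h 1+h<M) ⟩
  4 * φ M (1 + h) + M + 4 ∎
  where
  open ≡-Reasoning
  regroup : ∀ s a p → s + a + 2 * p ≡ s + p + a + p
  regroup = solve-∀
  regroup′ : ∀ a M b p → a + M + 4 + b + p ≡ a + b + p + M + 4
  regroup′ = solve-∀

n≤[1+m]*[n∸m] : ∀ {m n} → m < n → n ≤ suc m * (n ∸ m)
n≤[1+m]*[n∸m] {m} {n} m<n = begin
  n                 ≡⟨ m+[n∸m]≡n m<n ⟨
  suc m + d         ≤⟨ +-monoʳ-≤ (suc m) (m≤n*m d (suc m)) ⟩
  suc m + suc m * d ≡⟨ *-suc (suc m) d ⟨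
  suc m * suc d     ≡⟨ cong (suc m *_) (m∸n≡1+[m∸1+n] m<n) ⟨
  suc m * (n ∸ m)   ∎
  where
  open ≤-Reasoning
  d : ℕ
  d = n ∸ suc m

-- The defect 2^(h+3) of the identity ∑<φ is at most 4 φ(h) / (e+1).
φ-subEigen : ∀ e h → h < 2 * suc e → 4 * e * φ (2 * suc e) h ≤ suc e * ∑< (2 + h) (φ (2 * suc e))
φ-subEigen e h h<M = +-cancelˡ-≤ (E * P) _ _ (begin
  E * P + 4 * e * φ M h                 ≤⟨ +-monoˡ-≤ (4 * e * φ M h) defect≤ ⟩
  4 * φ M h + 4 * e * φ M h             ≤⟨ m≤m+n _ (E * (M + 4)) ⟩
  4 * φ M h + 4 * e * φ M h + E * (M + 4) ≡⟨ factor e (φ M h) M ⟩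
  E * (4 * φ M h + M + 4)               ≡⟨ cong (E *_) (∑<φ M h h<M) ⟨
  E * (∑< (2 + h) (φ M) + P)            ≡⟨ *-distribˡ-+ E (∑< (2 + h) (φ M)) P ⟩
  E * ∑< (2 + h) (φ M) + E * P          ≡⟨ +-comm (E * ∑< (2 + h) (φ M)) (E * P) ⟩
  E * P + E * ∑< (2 + h) (φ M)          ∎)
  where
  open ≤-Reasoning
  E M P : ℕ
  E = suc e
  M = 2 * suc e
  P = 2 ^ (3 + h)
  factor : ∀ e a M → 4 * a + 4 * e * a + suc e * (M + 4) ≡ suc e * (4 * a + M + 4)
  factor = solve-∀
  shuffle : ∀ p E → E * (8 * p) ≡ 4 * (p * (2 * E))
  shuffle = solve-∀
  defect≤ : E * P ≤ 4 * φ M h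
  defect≤ = begin
    E * P                   ≡⟨ cong (E *_) (^-distribˡ-+-* 2 3 h) ⟩
    E * (8 * 2 ^ h)         ≡⟨ shuffle (2 ^ h) E ⟩
    4 * (2 ^ h * M)         ≤⟨ *-monoʳ-≤ 4 (*-monoʳ-≤ (2 ^ h) (n≤[1+m]*[n∸m] h<M)) ⟩
    4 * φ M h               ∎

Γ-growth : ∀ e t m → 2 * suc e ≤ t ∸ 2 → (4 * e) ^ m ≤ Γ (suc m) t * (φ-max (2 * suc e) * suc e ^ m)
Γ-growth e t m M≤B = begin
  (4 * e) ^ m                                       ≤⟨ m≤m*n ((4 * e) ^ m) (φ M 0) ⟩
  (4 * e) ^ m * φ M 0                               ≡⟨ *-comm ((4 * e) ^ m) (φ M 0) ⟩
  φ M 0 * (4 * e) ^ m                               ≤⟨ continuations-growth (φ≤φ-max M) support (φ-subEigen′) m 0 ⟩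
  continuations (t ∸ 2) 0 m * (φ-max M * suc e ^ m) ≤⟨ *-monoˡ-≤ _ (continuations≤Γ t m) ⟩
  Γ (suc m) t * (φ-max M * suc e ^ m)               ∎
  where
  open ≤-Reasoning
  M : ℕ
  M = 2 * suc e
  support : ∀ h → t ∸ 2 ≤ h → φ M h ≡ 0
  support h B≤h = φ-support M h (≤-trans M≤B B≤h)
  φ-subEigen′ : ∀ h → h < t ∸ 2 → 4 * e * φ M h ≤ suc e * ∑< (2 + h) (φ M)
  φ-subEigen′ h _ with h <? M
  ... | yes h<M = φ-subEigen e h h<M
  ... | no h≮M rewrite φ-support M h (≮⇒≥ h≮M) | *-zeroʳ (4 * e) = z≤n

n<2^n : ∀ n → n < 2 ^ n
n<2^n zero    = s≤s z≤n
n<2^n (suc n) = +-mono-≤ (m^n>0 2 n) (≤-trans (n<2^n n) (m≤m+n (2 ^ n) 0))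

4^r*v≤2^[2r+v] : ∀ r v → 4 ^ r * v ≤ 2 ^ (2 * r + v)
4^r*v≤2^[2r+v] r v = begin
  4 ^ r * v           ≤⟨ *-monoʳ-≤ (4 ^ r) (<⇒≤ (n<2^n v)) ⟩
  4 ^ r * 2 ^ v       ≡⟨ cong (_* 2 ^ v) (^-*-assoc 2 2 r) ⟩
  2 ^ (2 * r) * 2 ^ v ≡⟨ ^-distribˡ-+-* 2 (2 * r) v ⟨
  2 ^ (2 * r + v)     ∎
  where open ≤-Reasoning

[m*n]^o≡m^o*n^o : ∀ m n o → (m * n) ^ o ≡ m ^ o * n ^ o
[m*n]^o≡m^o*n^o m n zero    = refl
[m*n]^o≡m^o*n^o m n (suc o) = trans (cong (m * n *_) ([m*n]^o≡m^o*n^o m n o)) (interchange m n (m ^ o) (n ^ o))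
  where
  interchange : ∀ a b x y → a * b * (x * y) ≡ a * x * (b * y)
  interchange = solve-∀

a^n*[a+n]≤[1+a]^n*a : ∀ a n → a ^ n * (a + n) ≤ suc a ^ n * a
a^n*[a+n]≤[1+a]^n*a a zero    = ≤-reflexive (cong (λ x → 1 * x) (+-identityʳ a))
a^n*[a+n]≤[1+a]^n*a a (suc n) = begin
  a * a ^ n * (a + suc n)           ≡⟨ split a (a ^ n) n ⟩
  a * (a ^ n * (a + n)) + a * a ^ n ≤⟨ +-mono-≤ (*-monoʳ-≤ a (a^n*[a+n]≤[1+a]^n*a a n))
                                                  (*-monoʳ-≤ a (^-monoˡ-≤ n (n≤1+n a))) ⟩
  a * (suc a ^ n * a) + a * suc a ^ n ≡⟨ merge a (suc a ^ n) ⟩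
  suc a * suc a ^ n * a             ∎
  where
  open ≤-Reasoning
  split : ∀ a x n → a * x * (a + suc n) ≡ a * (x * (a + n)) + a * x
  split = solve-∀
  merge : ∀ a y → a * (y * a) + a * y ≡ suc a * y * a
  merge = solve-∀

2*a^a≤[1+a]^a : ∀ a .{{_ : NonZero a}} → 2 * a ^ a ≤ suc a ^ a
2*a^a≤[1+a]^a a = *-cancelʳ-≤ (2 * a ^ a) (suc a ^ a) a
  (subst (_≤ suc a ^ a * a) (double (a ^ a) a) (a^n*[a+n]≤[1+a]^n*a a a))
  where
  double : ∀ x a → x * (a + a) ≡ 2 * x * a
  double = solve-∀

2^j*a^m≤[1+a]^m : ∀ a .{{_ : NonZero a}} j {m} → j * a ≤ m → 2 ^ j * a ^ m ≤ suc a ^ m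
2^j*a^m≤[1+a]^m a zero    {m} _       = ≤-trans (≤-reflexive (+-identityʳ (a ^ m))) (^-monoˡ-≤ m (n≤1+n a))
2^j*a^m≤[1+a]^m a (suc j) {m} [1+j]a≤m with m≤n⇒∃[o]m+o≡n [1+j]a≤m
... | d , refl = begin
  2 * 2 ^ j * a ^ (a + j * a + d)             ≡⟨ cong (λ x → 2 * 2 ^ j * a ^ x) (+-assoc a (j * a) d) ⟩
  2 * 2 ^ j * a ^ (a + (j * a + d))           ≡⟨ cong (λ x → 2 * 2 ^ j * x) (^-distribˡ-+-* a a (j * a + d)) ⟩
  2 * 2 ^ j * (a ^ a * a ^ (j * a + d))       ≡⟨ interchange 2 (2 ^ j) (a ^ a) (a ^ (j * a + d)) ⟩
  2 * a ^ a * (2 ^ j * a ^ (j * a + d))       ≤⟨ *-mono-≤ (2*a^a≤[1+a]^a a) (2^j*a^m≤[1+a]^m a j (m≤m+n (j * a) d)) ⟩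
  suc a ^ a * suc a ^ (j * a + d)             ≡⟨ ^-distribˡ-+-* (suc a) a (j * a + d) ⟨
  suc a ^ (a + (j * a + d))                   ≡⟨ cong (suc a ^_) (+-assoc a (j * a) d) ⟨
  suc a ^ (a + j * a + d)                     ∎
  where
  open ≤-Reasoning
  interchange : ∀ t x y z → t * x * (y * z) ≡ t * y * (x * z)
  interchange = solve-∀

m*m≤n<[1+o]*[1+o]⇒m≤o : ∀ {m n o} → m * m ≤ n → n < suc o * suc o → m ≤ o
m*m≤n<[1+o]*[1+o]⇒m≤o {m} {n} {o} m²≤n n<[1+o]² with m ≤? o
... | yes m≤o = m≤o
... | no m≰o  = ⊥-elim (<⇒≱ n<[1+o]² (≤-trans (*-mono-≤ (≰⇒> m≰o) (≰⇒> m≰o)) m²≤n))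

a*n+[1+b]≤n*n : ∀ a b n → a + suc b ≤ n → a * n + suc b ≤ n * n
a*n+[1+b]≤n*n a b n@(suc _) a+1+b≤n = begin
  a * n + suc b     ≤⟨ +-monoʳ-≤ (a * n) (m≤m*n (suc b) n) ⟩
  a * n + suc b * n ≡⟨ *-distribʳ-+ n a (suc b) ⟨
  (a + suc b) * n   ≤⟨ *-monoˡ-≤ n a+1+b≤n ⟩
  n * n             ∎
  where open ≤-Reasoning
a*n+[1+b]≤n*n a b zero a+1+b≤0 with () ← m+n≤o⇒n≤o a a+1+b≤0

module _ {e P q : ℕ} .{{_ : NonZero P}} (P/q<4e/[1+e] : suc (P * suc e) ≤ 4 * e * q) where

  private
    E M V α : ℕ
    E = suc e
    M = 2 * E
    V = φ-max M
    α = P * E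

  -- The r entries outside the walk cost (4q)^r ≤ 2^(2r) q^r, which the gap between
  -- α^m and (1+α)^m absorbs once m ≥ (2r+V)α.
  Γ-bound : ∀ t r m → M ≤ t ∸ 2 → (2 * r + V) * α ≤ m → P ^ (r + m) ≤ Γ (suc m) t * q ^ (r + m)
  Γ-bound t r m M≤B [2r+V]α≤m = *-cancelʳ-≤ _ _ W {{W≢0}} (begin
    P ^ (r + m) * W                     ≡⟨ cong (_* W) (^-distribˡ-+-* P r m) ⟩
    P ^ r * P ^ m * (V * E ^ m)         ≡⟨ regroup (P ^ r) (P ^ m) V (E ^ m) ⟩
    P ^ r * (V * (P ^ m * E ^ m))       ≡⟨ cong (λ x → P ^ r * (V * x)) ([m*n]^o≡m^o*n^o P E m) ⟨
    P ^ r * (V * α ^ m)                 ≤⟨ *-monoˡ-≤ (V * α ^ m) (^-monoˡ-≤ r P≤4q) ⟩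
    (4 * q) ^ r * (V * α ^ m)           ≡⟨ cong (_* (V * α ^ m)) ([m*n]^o≡m^o*n^o 4 q r) ⟩
    4 ^ r * q ^ r * (V * α ^ m)         ≡⟨ regroup′ (4 ^ r) (q ^ r) V (α ^ m) ⟩
    q ^ r * (4 ^ r * V * α ^ m)         ≤⟨ *-monoʳ-≤ (q ^ r) (*-monoˡ-≤ (α ^ m) (4^r*v≤2^[2r+v] r V)) ⟩
    q ^ r * (2 ^ (2 * r + V) * α ^ m)   ≤⟨ *-monoʳ-≤ (q ^ r) (2^j*a^m≤[1+a]^m α {{m*n≢0 P E}} (2 * r + V) [2r+V]α≤m) ⟩
    q ^ r * suc α ^ m                   ≤⟨ *-monoʳ-≤ (q ^ r) (^-monoˡ-≤ m P/q<4e/[1+e]) ⟩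
    q ^ r * (4 * e * q) ^ m             ≡⟨ cong (q ^ r *_) ([m*n]^o≡m^o*n^o (4 * e) q m) ⟩
    q ^ r * ((4 * e) ^ m * q ^ m)       ≤⟨ *-monoʳ-≤ (q ^ r) (*-monoˡ-≤ (q ^ m) (Γ-growth e t m M≤B)) ⟩
    q ^ r * (Γ (suc m) t * W * q ^ m)   ≡⟨ regroup″ (q ^ r) (Γ (suc m) t) W (q ^ m) ⟩
    Γ (suc m) t * (q ^ r * q ^ m) * W   ≡⟨ cong (λ x → Γ (suc m) t * x * W) (^-distribˡ-+-* q r m) ⟨
    Γ (suc m) t * q ^ (r + m) * W       ∎)
    where
    open ≤-Reasoning
    W : ℕ
    W = V * E ^ m
    W≢0 : NonZero W
    W≢0 = m*n≢0 V (E ^ m) {{m*n≢0 (2 ^ M) (suc M * M) {{m^n≢0 2 M}}}} {{m^n≢0 E m}}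
    P≤4q : P ≤ 4 * q
    P≤4q = <⇒≤ (*-cancelʳ-< E P (4 * q) (begin-strict
      P * E         <⟨ P/q<4e/[1+e] ⟩
      4 * e * q     ≡⟨ swap e q ⟩
      4 * q * e     ≤⟨ *-monoʳ-≤ (4 * q) (n≤1+n e) ⟩
      4 * q * E     ∎))
      where
      swap : ∀ e q → 4 * e * q ≡ 4 * q * e
      swap = solve-∀
    regroup : ∀ a b v f → a * b * (v * f) ≡ a * (v * (b * f))
    regroup = solve-∀
    regroup′ : ∀ a b v x → a * b * (v * x) ≡ b * (a * v * x)
    regroup′ = solve-∀
    regroup″ : ∀ a g w b → a * (g * w * b) ≡ g * (a * b) * w
    regroup″ = solve-∀

  Γ-bound-after-2t : ∀ t m → M ≤ t ∸ 2 → (2 * suc (2 * t) + V) * α ≤ m →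
    P ^ (suc (2 * t) + m) ≤ Γ (suc (2 * t) + m ∸ 2 * t) t * q ^ (suc (2 * t) + m)
  Γ-bound-after-2t t m M≤B budget =
    subst (λ n → P ^ r+m ≤ Γ n t * q ^ r+m) (sym index) (Γ-bound t (suc (2 * t)) m M≤B budget)
    where
    r+m : ℕ
    r+m = suc (2 * t) + m
    index : r+m ∸ 2 * t ≡ suc m
    index = trans (cong (_∸ 2 * t) (sym (+-suc (2 * t) m))) (m+n∸m≡n (2 * t) (suc m))

  Γ-eventually : ∃ λ K → ∀ k t → K ≤ k → t * t ≤ k → k < suc t * suc t →
    P ^ k ≤ Γ (k ∸ 2 * t) t * q ^ k
  Γ-eventually = T * T , bound
    where
    A C T : ℕ
    A = 4 * α + 2
    C = (2 + V) * α
    T = A + suc C + (M + 2)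
    collect : ∀ α t V → suc (2 * t) + (2 * suc (2 * t) + V) * α ≡ (4 * α + 2) * t + suc ((2 + V) * α)
    collect = solve-∀
    budget : ∀ t → T ≤ t → suc (2 * t) + (2 * suc (2 * t) + V) * α ≤ t * t
    budget t T≤t = begin
      suc (2 * t) + (2 * suc (2 * t) + V) * α ≡⟨ collect α t V ⟩
      A * t + suc C                           ≤⟨ a*n+[1+b]≤n*n A C t (m+n≤o⇒m≤o (A + suc C) T≤t) ⟩
      t * t                                   ∎
      where open ≤-Reasoning
    ceiling : ∀ t → T ≤ t → M ≤ t ∸ 2
    ceiling t T≤t = ≤-trans (≤-reflexive (sym (m+n∸n≡m M 2))) (∸-monoˡ-≤ 2 (m+n≤o⇒n≤o (A + suc C) T≤t))
    bound : ∀ k t → T * T ≤ k → t * t ≤ k → k < suc t * suc t → P ^ k ≤ Γ (k ∸ 2 * t) t * q ^ k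
    bound k t T²≤k t²≤k k<[1+t]²
      with T≤t ← m*m≤n<[1+o]*[1+o]⇒m≤o T²≤k k<[1+t]²
         | m≤n⇒∃[o]m+o≡n (m+n≤o⇒m≤o (suc (2 * t)) (≤-trans (budget t T≤t) t²≤k))
    ... | m , refl = Γ-bound-after-2t t m (ceiling t T≤t) (+-cancelˡ-≤ (suc (2 * t)) _ _ (≤-trans (budget t T≤t) t²≤k))

mainTheorem12 : ∀ (p q : ℕ) → 0 < q → p < 4 * q →
    ∃ λ (K : ℕ) → ∀ (k t : ℕ) → K ≤ k → t * t ≤ k → k < suc t * suc t →
      p ^ k ≤ Γ (k ∸ 2 * t) t * q ^ k
mainTheorem12 p zero () _
mainTheorem12 p (suc q′) _ p<4q =
  let K , bound = Γ-eventually {e = 4 * suc q′} {P = 3 + 4 * q′} {q = suc q′} (≤-reflexive (ratio q′))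
  in K , λ k t K≤k t²≤k k<[1+t]² → ≤-trans (^-monoˡ-≤ k p≤4q-1) (bound k t K≤k t²≤k k<[1+t]²)
  where
  -- e = 4q and P = 4q - 1 give P/q < 4e/(e+1), as (4q-1)(4q+1) + 1 = 16q².
  ratio : ∀ q′ → suc ((3 + 4 * q′) * suc (4 * suc q′)) ≡ 4 * (4 * suc q′) * suc q′
  ratio = solve-∀
  p≤4q-1 : p ≤ 3 + 4 * q′
  p≤4q-1 = ≤-pred (subst (p <_) (*-suc 4 q′) p<4q)
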